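{- Let $t$ be a $\lambda$-term. There is a $\mathsf{shuf}$-normalizing derivation $d$ from $t$ if and only if there is a $\mathsf{vsub}$-normalizing derivation $e$ from $t$. Moreover, for such $d$ and $e$, $|d|_{\beta_v}=|e|_{\mathtt e}$.
   Context: $\lambda$-terms: $t,u,s::= v\mid tu$, values $v::= x\mid \lambda x.t$, up to $\alpha$; $t\{x\leftarrow u\}$ capture-avoiding substitution. Shuffling calculus: balanced contexts $B::=\langle\cdot\rangle\mid tB\mid Bt\mid (\lambda x.B)t$; $\to_{\mathsf{shuf}}$ is the closure under balanced contexts of $((\lambda x.t)u)s\mapsto(\lambda x.ts)u$ ($x\notin\mathrm{fv}(s)$), $v((\lambda x.s)u)\mapsto(\lambda x.vs)u$ ($v$ value, $x\notin\mathrm{fv}(v)$) (the $\sigma$-steps), and $(\lambda x.t)v\mapsto t\{x\leftarrow v\}$ ($v$ a value; the $\beta_v$-steps). $|d|_{\beta_v}$ counts the $\beta_v$-steps of $d$. Value substitution calculus: vsub-terms $t,u::= v\mid tu\mid t[x\leftarrow u]$, vsub-values $v::=x\mid\lambda x.t$; $t[x\leftarrow u]$ binds $x$ in $t$. Evaluation contexts $E::=\langle\cdot\rangle\mid tE\mid Et\mid E[x\leftarrow u]\mid t[x\leftarrow E]$; substitution contexts $L::=\langle\cdot\rangle\mid L[x\leftarrow u]$. $\to_{\mathtt m}$: closure under evaluation contexts of $L\langle\lambda x.t\rangle u\mapsto L\langle t[x\leftarrow u]\rangle$; $\to_{\mathtt e}$: closure of $t[x\leftarrow L\langle v\rangle]\mapsto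 L\langle t\{x\leftarrow v\}\rangle$ ($v$ vsub-value; bound variables of $L$ not free in $u$, resp. $t$); $\to_{\mathsf{vsub}}=\to_{\mathtt m}\cup\to_{\mathtt e}$; $|e|_{\mathtt e}$ counts $\mathtt e$-steps. A derivation is normalizing if it ends in a normal form. -}

module Defs where

open import Data.Nat using (ℕ; zero; suc; _+_)
open import Data.Fin using (Fin; zero; suc)
open import Data.Product using (Σ; _×_; _,_)
open import Data.Empty using (⊥)
open import Relation.Nullary using (¬_)

-- Renaming / substitution helpers (well-scoped de Bruijn; α-equivalence
-- is syntactic identity).

Ren : ℕ → ℕ → Set
Ren n m = Fin n → Fin m

extR : ∀ {n m} → Ren n m → Ren (suc n) (suc m)
extR ρ zero    = zero
extR ρ (suc i) = suc (ρ i)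

data Term (n : ℕ) : Set where
  var : Fin n → Term n
  lam : Term (suc n) → Term n
  app : Term n → Term n → Term n

data IsValue {n : ℕ} : Term n → Set where
  var-val : ∀ x → IsValue (var x)
  lam-val : ∀ t → IsValue (lam t)

rename : ∀ {n m} → Ren n m → Term n → Term m
rename ρ (var x)   = var (ρ x)
rename ρ (lam t)   = lam (rename (extR ρ) t)
rename ρ (app t u) = app (rename ρ t) (rename ρ u)

shift : ∀ {n} → Term n → Term (suc n)
shift = rename suc

Sub : ℕ → ℕ → Set
Sub n m = Fin n → Term m

extS : ∀ {n m} → Sub n m → Sub (suc n) (suc m)
extS σ zero    = var zero
extS σ (suc i) = shift (σ i)

subst : ∀ {n m} → Sub n m → Term n → Term m
subst σ (var x)   = σ x
subst σ (lam t)   = lam (subst (extS σ) t)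
subst σ (app t u) = app (subst σ t) (subst σ u)

_[0≔_] : ∀ {n} → Term (suc n) → Term n → Term n
t [0≔ u ] = subst σ t
  where
  σ : Sub _ _
  σ zero    = u
  σ (suc i) = var i

data ShufKind : Set where
  σ-step βv-step : ShufKind

data _↦shuf[_]_ {n : ℕ} : Term n → ShufKind → Term n → Set where
  -- ((λx.t)u)s ↦ (λx.ts)u   (x ∉ fv(s): s is shifted under the binder)
  σ₁ : ∀ t u s → app (app (lam t) u) s ↦shuf[ σ-step ] app (lam (app t (shift s))) u
  -- v((λx.s)u) ↦ (λx.vs)u   (v value, x ∉ fv(v))
  σ₃ : ∀ v s u → IsValue v → app v (app (lam s) u) ↦shuf[ σ-step ] app (lam (app (shift v) s)) u
  βv : ∀ t v → IsValue v → app (lam t) v ↦shuf[ βv-step ] (t [0≔ v ])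

data _→shuf[_]_ {n : ℕ} : Term n → ShufKind → Term n → Set where
  root   : ∀ {t u k} → t ↦shuf[ k ] u → t →shuf[ k ] u
  appR   : ∀ {t u u' k} → u →shuf[ k ] u' → app t u →shuf[ k ] app t u'
  appL   : ∀ {t t' u k} → t →shuf[ k ] t' → app t u →shuf[ k ] app t' u
  lamApp : ∀ {t t' : Term (suc n)} {u k} → t →shuf[ k ] t' → app (lam t) u →shuf[ k ] app (lam t') u

data ShufDer {n : ℕ} : Term n → Term n → Set where
  done : ∀ {t} → ShufDer t t
  step : ∀ {t u s k} → t →shuf[ k ] u → ShufDer u s → ShufDer t s

βvCount : ∀ {n} {t u : Term n} → ShufDer t u → ℕ
βvCount done                      = 0
βvCount (step {k = σ-step}  _ d)  = βvCount d
βvCount (step {k = βv-step} _ d)  = suc (βvCount d)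

ShufNormal : ∀ {n} → Term n → Set
ShufNormal t = ∀ {k u} → ¬ (t →shuf[ k ] u)

data VTerm (n : ℕ) : Set where
  var  : Fin n → VTerm n
  lam  : VTerm (suc n) → VTerm n
  app  : VTerm n → VTerm n → VTerm n
  esub : VTerm (suc n) → VTerm n → VTerm n

data IsVValue {n : ℕ} : VTerm n → Set where
  var-val : ∀ x → IsVValue (var x)
  lam-val : ∀ t → IsVValue (lam t)

vrename : ∀ {n m} → Ren n m → VTerm n → VTerm m
vrename ρ (var x)    = var (ρ x)
vrename ρ (lam t)    = lam (vrename (extR ρ) t)
vrename ρ (app t u)  = app (vrename ρ t) (vrename ρ u)
vrename ρ (esub t u) = esub (vrename (extR ρ) t) (vrename ρ u)

VSub : ℕ → ℕ → Set
VSub n m = Fin n → VTerm m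

vextS : ∀ {n m} → VSub n m → VSub (suc n) (suc m)
vextS σ zero    = var zero
vextS σ (suc i) = vrename suc (σ i)

vsubst : ∀ {n m} → VSub n m → VTerm n → VTerm m
vsubst σ (var x)    = σ x
vsubst σ (lam t)    = lam (vsubst (vextS σ) t)
vsubst σ (app t u)  = app (vsubst σ t) (vsubst σ u)
vsubst σ (esub t u) = esub (vsubst (vextS σ) t) (vsubst σ u)

-- substitution contexts  L ::= ⟨·⟩ | L[x←u]
-- SCtx n m : outside scope n, scope at the hole m
data SCtx (n : ℕ) : ℕ → Set where
  hole : SCtx n n
  _[_] : ∀ {m} → SCtx (suc n) m → VTerm n → SCtx n m

plug : ∀ {n m} → SCtx n m → VTerm m → VTerm n
plug hole      t = t
plug (L [ u ]) t = esub (plug L t) u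

wkL : ∀ {n m} → SCtx n m → Ren n m
wkL hole      i = i
wkL (L [ u ]) i = wkL L (suc i)

-- the substitution {x←v} composed with weakening t past L's binders
eσ : ∀ {n m} → SCtx n m → VTerm m → VSub (suc n) m
eσ L v zero    = v
eσ L v (suc i) = var (wkL L i)

data VKind : Set where
  m-step e-step : VKind

data _↦vsub[_]_ {n : ℕ} : VTerm n → VKind → VTerm n → Set where
  -- L⟨λx.t⟩u ↦ L⟨t[x←u]⟩   (bound vars of L not free in u)
  mRule : ∀ {m} (L : SCtx n m) (t : VTerm (suc m)) (u : VTerm n) →
          app (plug L (lam t)) u ↦vsub[ m-step ] plug L (esub t (vrename (wkL L) u))
  -- t[x←L⟨v⟩] ↦ L⟨t{x←v}⟩   (v value; bound vars of L not free in t)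
  eRule : ∀ {m} (t : VTerm (suc n)) (L : SCtx n m) (v : VTerm m) → IsVValue v →
          esub t (plug L v) ↦vsub[ e-step ] plug L (vsubst (eσ L v) t)

data _→vsub[_]_ {n : ℕ} : VTerm n → VKind → VTerm n → Set where
  root  : ∀ {t u k} → t ↦vsub[ k ] u → t →vsub[ k ] u
  appR  : ∀ {t u u' k} → u →vsub[ k ] u' → app t u →vsub[ k ] app t u'
  appL  : ∀ {t t' u k} → t →vsub[ k ] t' → app t u →vsub[ k ] app t' u
  esubL : ∀ {t t' : VTerm (suc n)} {u k} → t →vsub[ k ] t' → esub t u →vsub[ k ] esub t' u
  esubR : ∀ {t u u' k} → u →vsub[ k ] u' → esub t u →vsub[ k ] esub t u'

data VDer {n : ℕ} : VTerm n → VTerm n → Set where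
  done : ∀ {t} → VDer t t
  step : ∀ {t u s k} → t →vsub[ k ] u → VDer u s → VDer t s

eCount : ∀ {n} {t u : VTerm n} → VDer t u → ℕ
eCount done                    = 0
eCount (step {k = m-step} _ e) = eCount e
eCount (step {k = e-step} _ e) = suc (eCount e)

VNormal : ∀ {n} → VTerm n → Set
VNormal t = ∀ {k u} → ¬ (t →vsub[ k ] u)

embed : ∀ {n} → Term n → VTerm n
embed (var x)   = var x
embed (lam t)   = lam (embed t)
embed (app t u) = app (embed t) (embed u)

-- The proof compares shuf with vsub through the embedding of λ-terms.
-- 1. vsub is presented structurally (answers L⟨v⟩ as inductive predicates) and
--    shown to have the diamond property, steps keeping their kind.  Hence
--    (random descent) all normalizing derivations from a term have the same
--    number of e-steps, and any step from a normalizing term uses up its share.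
-- 2. A structural equivalence ~, commuting explicit substitutions with the
--    surrounding constructs, is a strong bisimulation for vsub.
-- 3. Call p a representation of t when embed t and p are m-joinable up to ~.
--    A σ-step of t keeps its representations, a βv-step is matched by a vsub
--    derivation with exactly one e-step, and a representation of a shuf-normal
--    term m-normalizes to a vsub-normal form.
-- 4. So a normalizing shuf derivation yields a normalizing vsub derivation with
--    as many e-steps as βv-steps, which with 1 gives the equality of counts.
--    Conversely, a term whose embedding normalizes is shuf-normalized by
--    induction on the e-steps left and a measure that σ-steps decrease.

module Submission where

open import Defs
open import Data.Nat using (ℕ)
open import Data.Product using (Σ; _×_; _,_)
open import Relation.Binary.PropositionalEquality using (_≡_)

open import Data.Nat using (zero; suc; _+_; _*_; _<_; s≤s)
open import Data.Nat.Properties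
  using (+-comm; +-assoc; m≤m+n; n<1+n; <⇒≤; +-monoˡ-<; +-monoˡ-≤; +-mono-≤-<; *-monoˡ-≤; *-monoʳ-≤; *-monoʳ-<;
         +-commutativeSemigroup)
open import Data.Nat.Tactic.RingSolver using (solve-∀)
open import Data.Nat.Induction using (<-wellFounded)
open import Induction.WellFounded using (Acc; acc)
open import Algebra.Properties.CommutativeSemigroup +-commutativeSemigroup using (x∙yz≈y∙xz)
open import Data.Fin using (zero; suc)
open import Data.Product using (∃)
open import Data.Sum using (_⊎_; inj₁; inj₂)
open import Data.Empty using (⊥-elim)
open import Function using (_∘_)
open import Relation.Nullary using (¬_)
open import Relation.Binary.PropositionalEquality
  using (refl; sym; trans; cong; cong₂; _≗_)
  renaming (subst to ≡-subst)
open import Relation.Binary.Construct.Closure.ReflexiveTransitive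
  using (Star; ε; _◅_; _◅◅_; gmap; reverse)

private variable
  n m l : ℕ

extR-cong : {ρ ρ' : Ren n m} → ρ ≗ ρ' → extR ρ ≗ extR ρ'
extR-cong e zero    = refl
extR-cong e (suc i) = cong suc (e i)

extR-∘ : (ρ : Ren m l) (ρ' : Ren n m) → extR ρ ∘ extR ρ' ≗ extR (ρ ∘ ρ')
extR-∘ ρ ρ' zero    = refl
extR-∘ ρ ρ' (suc i) = refl

extR-id : {ρ : Ren n n} → (∀ i → ρ i ≡ i) → ∀ i → extR ρ i ≡ i
extR-id e zero    = refl
extR-id e (suc i) = cong suc (e i)

vrename-cong : {ρ ρ' : Ren n m} → ρ ≗ ρ' → (t : VTerm n) → vrename ρ t ≡ vrename ρ' t
vrename-cong e (var x)    = cong var (e x)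
vrename-cong e (lam t)    = cong lam (vrename-cong (extR-cong e) t)
vrename-cong e (app t u)  = cong₂ app (vrename-cong e t) (vrename-cong e u)
vrename-cong e (esub t u) = cong₂ esub (vrename-cong (extR-cong e) t) (vrename-cong e u)

vrename-∘ : (ρ : Ren m l) (ρ' : Ren n m) (t : VTerm n) → vrename ρ (vrename ρ' t) ≡ vrename (ρ ∘ ρ') t
vrename-∘ ρ ρ' (var x)    = refl
vrename-∘ ρ ρ' (lam t)    =
  cong lam (trans (vrename-∘ (extR ρ) (extR ρ') t) (vrename-cong (extR-∘ ρ ρ') t))
vrename-∘ ρ ρ' (app t u)  = cong₂ app (vrename-∘ ρ ρ' t) (vrename-∘ ρ ρ' u)
vrename-∘ ρ ρ' (esub t u) =
  cong₂ esub (trans (vrename-∘ (extR ρ) (extR ρ') t) (vrename-cong (extR-∘ ρ ρ') t)) (vrename-∘ ρ ρ' u)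

vrename-id : {ρ : Ren n n} → (∀ i → ρ i ≡ i) → (t : VTerm n) → vrename ρ t ≡ t
vrename-id e (var x)    = cong var (e x)
vrename-id e (lam t)    = cong lam (vrename-id (extR-id e) t)
vrename-id e (app t u)  = cong₂ app (vrename-id e t) (vrename-id e u)
vrename-id e (esub t u) = cong₂ esub (vrename-id (extR-id e) t) (vrename-id e u)

vrename-wk : (ρ : Ren n m) (t : VTerm n) →
             vrename (extR ρ) (vrename suc t) ≡ vrename suc (vrename ρ t)
vrename-wk ρ t = trans (vrename-∘ (extR ρ) suc t) (sym (vrename-∘ suc ρ t))

vextS-cong : {σ σ' : VSub n m} → σ ≗ σ' → vextS σ ≗ vextS σ'
vextS-cong e zero    = refl
vextS-cong e (suc i) = cong (vrename suc) (e i)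

vsubst-cong : {σ σ' : VSub n m} → σ ≗ σ' → (t : VTerm n) → vsubst σ t ≡ vsubst σ' t
vsubst-cong e (var x)    = e x
vsubst-cong e (lam t)    = cong lam (vsubst-cong (vextS-cong e) t)
vsubst-cong e (app t u)  = cong₂ app (vsubst-cong e t) (vsubst-cong e u)
vsubst-cong e (esub t u) = cong₂ esub (vsubst-cong (vextS-cong e) t) (vsubst-cong e u)

vextS-extR : (σ : VSub m l) (ρ : Ren n m) → vextS σ ∘ extR ρ ≗ vextS (σ ∘ ρ)
vextS-extR σ ρ zero    = refl
vextS-extR σ ρ (suc i) = refl

vsubst-vrename : (σ : VSub m l) (ρ : Ren n m) (t : VTerm n) →
                 vsubst σ (vrename ρ t) ≡ vsubst (σ ∘ ρ) t
vsubst-vrename σ ρ (var x)    = refl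
vsubst-vrename σ ρ (lam t)    =
  cong lam (trans (vsubst-vrename (vextS σ) (extR ρ) t) (vsubst-cong (vextS-extR σ ρ) t))
vsubst-vrename σ ρ (app t u)  = cong₂ app (vsubst-vrename σ ρ t) (vsubst-vrename σ ρ u)
vsubst-vrename σ ρ (esub t u) =
  cong₂ esub (trans (vsubst-vrename (vextS σ) (extR ρ) t) (vsubst-cong (vextS-extR σ ρ) t))
             (vsubst-vrename σ ρ u)

extR-vextS : (ρ : Ren m l) (σ : VSub n m) → vrename (extR ρ) ∘ vextS σ ≗ vextS (vrename ρ ∘ σ)
extR-vextS ρ σ zero    = refl
extR-vextS ρ σ (suc i) = vrename-wk ρ (σ i)

vrename-vsubst : (ρ : Ren m l) (σ : VSub n m) (t : VTerm n) →
                 vrename ρ (vsubst σ t) ≡ vsubst (vrename ρ ∘ σ) t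
vrename-vsubst ρ σ (var x)    = refl
vrename-vsubst ρ σ (lam t)    =
  cong lam (trans (vrename-vsubst (extR ρ) (vextS σ) t) (vsubst-cong (extR-vextS ρ σ) t))
vrename-vsubst ρ σ (app t u)  = cong₂ app (vrename-vsubst ρ σ t) (vrename-vsubst ρ σ u)
vrename-vsubst ρ σ (esub t u) =
  cong₂ esub (trans (vrename-vsubst (extR ρ) (vextS σ) t) (vsubst-cong (extR-vextS ρ σ) t))
             (vrename-vsubst ρ σ u)

vsubst-wk : (σ : VSub n m) (t : VTerm n) →
            vsubst (vextS σ) (vrename suc t) ≡ vrename suc (vsubst σ t)
vsubst-wk σ t = trans (vsubst-vrename (vextS σ) suc t) (sym (vrename-vsubst suc σ t))

vextS-vextS : (σ : VSub m l) (τ : VSub n m) → vsubst (vextS σ) ∘ vextS τ ≗ vextS (vsubst σ ∘ τ)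
vextS-vextS σ τ zero    = refl
vextS-vextS σ τ (suc i) = vsubst-wk σ (τ i)

vsubst-vsubst : (σ : VSub m l) (τ : VSub n m) (t : VTerm n) →
                vsubst σ (vsubst τ t) ≡ vsubst (vsubst σ ∘ τ) t
vsubst-vsubst σ τ (var x)    = refl
vsubst-vsubst σ τ (lam t)    =
  cong lam (trans (vsubst-vsubst (vextS σ) (vextS τ) t) (vsubst-cong (vextS-vextS σ τ) t))
vsubst-vsubst σ τ (app t u)  = cong₂ app (vsubst-vsubst σ τ t) (vsubst-vsubst σ τ u)
vsubst-vsubst σ τ (esub t u) =
  cong₂ esub (trans (vsubst-vsubst (vextS σ) (vextS τ) t) (vsubst-cong (vextS-vextS σ τ) t))
             (vsubst-vsubst σ τ u)

vextS-id : {σ : VSub n n} → (∀ i → σ i ≡ var i) → ∀ i → vextS σ i ≡ var i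
vextS-id e zero    = refl
vextS-id e (suc i) = cong (vrename suc) (e i)

vsubst-id : {σ : VSub n n} → (∀ i → σ i ≡ var i) → (t : VTerm n) → vsubst σ t ≡ t
vsubst-id e (var x)    = e x
vsubst-id e (lam t)    = cong lam (vsubst-id (vextS-id e) t)
vsubst-id e (app t u)  = cong₂ app (vsubst-id e t) (vsubst-id e u)
vsubst-id e (esub t u) = cong₂ esub (vsubst-id (vextS-id e) t) (vsubst-id e u)

embed-rename : (ρ : Ren n m) (t : Term n) → embed (rename ρ t) ≡ vrename ρ (embed t)
embed-rename ρ (var x)   = refl
embed-rename ρ (lam t)   = cong lam (embed-rename (extR ρ) t)
embed-rename ρ (app t u) = cong₂ app (embed-rename ρ t) (embed-rename ρ u)

embed-extS : (σ : Sub n m) → embed ∘ extS σ ≗ vextS (embed ∘ σ)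
embed-extS σ zero    = refl
embed-extS σ (suc i) = embed-rename suc (σ i)

embed-subst : (σ : Sub n m) (t : Term n) → embed (subst σ t) ≡ vsubst (embed ∘ σ) (embed t)
embed-subst σ (var x)   = refl
embed-subst σ (lam t)   =
  cong lam (trans (embed-subst (extS σ) t) (vsubst-cong (embed-extS σ) (embed t)))
embed-subst σ (app t u) = cong₂ app (embed-subst σ t) (embed-subst σ u)

-- A structural presentation of vsub
--
-- The root rules of vsub are stated with a substitution context L and
-- the plugging function, which cannot be matched on.  We describe instead
-- the terms of the shapes L⟨λx.c⟩ and L⟨v⟩ (answers) by inductive
-- predicates, and compute the contracta by recursion on those proofs.

sub₀ : VTerm n → VSub (suc n) n
sub₀ v zero    = v
sub₀ v (suc i) = var i

wk : VTerm n → VTerm (suc n)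
wk = vrename suc

wk₁ : VTerm (suc n) → VTerm (suc (suc n))
wk₁ = vrename (extR suc)

data LamAnswer {n : ℕ} : VTerm n → Set where
  λ-here  : (c : VTerm (suc n)) → LamAnswer (lam c)
  λ-under : {p : VTerm (suc n)} {u : VTerm n} → LamAnswer p → LamAnswer (esub p u)

data Answer {n : ℕ} : VTerm n → Set where
  v-here  : {v : VTerm n} → IsVValue v → Answer v
  v-under : {p : VTerm (suc n)} {u : VTerm n} → Answer p → Answer (esub p u)

mContract : {p : VTerm n} → LamAnswer p → VTerm n → VTerm n
mContract (λ-here c)          s = esub c s
mContract (λ-under {u = u} a) s = esub (mContract a (wk s)) u

eContract : {p : VTerm n} → VTerm (suc n) → Answer p → VTerm n
eContract t (v-here {v} _)      = vsubst (sub₀ v) t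
eContract t (v-under {u = u} a) = esub (eContract (wk₁ t) a) u

infix 4 _⟶[_]_
data _⟶[_]_ {n : ℕ} : VTerm n → VKind → VTerm n → Set where
  m-rule : {p s : VTerm n} (a : LamAnswer p) → app p s ⟶[ m-step ] mContract a s
  e-rule : {t : VTerm (suc n)} {p : VTerm n} (a : Answer p) → esub t p ⟶[ e-step ] eContract t a
  ξappL  : ∀ {t t' u k} → t ⟶[ k ] t' → app t u ⟶[ k ] app t' u
  ξappR  : ∀ {t u u' k} → u ⟶[ k ] u' → app t u ⟶[ k ] app t u'
  ξsubL  : ∀ {t t' : VTerm (suc n)} {u k} → t ⟶[ k ] t' → esub t u ⟶[ k ] esub t' u
  ξsubR  : ∀ {t u u' k} → u ⟶[ k ] u' → esub t u ⟶[ k ] esub t u'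

⟶-resp-≡ : ∀ {p q q' : VTerm n} {k} → q ≡ q' → p ⟶[ k ] q → p ⟶[ k ] q'
⟶-resp-≡ refl s = s

value-stuck : ∀ {v v' : VTerm n} {k} → IsVValue v → ¬ (v ⟶[ k ] v')
value-stuck (var-val x) ()
value-stuck (lam-val t) ()

-- The shape predicates are propositions, so a redex has a unique contractum.

isVValue-irr : {v : VTerm n} (a b : IsVValue v) → a ≡ b
isVValue-irr (var-val x) (var-val .x) = refl
isVValue-irr (lam-val t) (lam-val .t) = refl

lamAnswer-irr : {p : VTerm n} (a b : LamAnswer p) → a ≡ b
lamAnswer-irr (λ-here c)  (λ-here .c) = refl
lamAnswer-irr (λ-under a) (λ-under b) = cong λ-under (lamAnswer-irr a b)

answer-irr : {p : VTerm n} (a b : Answer p) → a ≡ b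
answer-irr (v-here x)  (v-here y)  = cong v-here (isVValue-irr x y)
answer-irr (v-here ()) (v-under b)
answer-irr (v-under a) (v-here ())
answer-irr (v-under a) (v-under b) = cong v-under (answer-irr a b)

ValueSub : VSub n m → Set
ValueSub σ = ∀ i → IsVValue (σ i)

sub₀-value : {v : VTerm n} → IsVValue v → ValueSub (sub₀ v)
sub₀-value h zero    = h
sub₀-value h (suc i) = var-val i

vrename-val : (ρ : Ren n m) {v : VTerm n} → IsVValue v → IsVValue (vrename ρ v)
vrename-val ρ (var-val x) = var-val _
vrename-val ρ (lam-val t) = lam-val _

vextS-value : {σ : VSub n m} → ValueSub σ → ValueSub (vextS σ)
vextS-value h zero    = var-val zero
vextS-value h (suc i) = vrename-val suc (h i)

vsubst-val : {σ : VSub n m} → ValueSub σ → {v : VTerm n} → IsVValue v → IsVValue (vsubst σ v)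
vsubst-val h (var-val x) = h x
vsubst-val h (lam-val t) = lam-val _

vrename-lamAnswer : (ρ : Ren n m) {p : VTerm n} → LamAnswer p → LamAnswer (vrename ρ p)
vrename-lamAnswer ρ (λ-here c)  = λ-here _
vrename-lamAnswer ρ (λ-under a) = λ-under (vrename-lamAnswer (extR ρ) a)

vrename-answer : (ρ : Ren n m) {p : VTerm n} → Answer p → Answer (vrename ρ p)
vrename-answer ρ (v-here h)  = v-here (vrename-val ρ h)
vrename-answer ρ (v-under a) = v-under (vrename-answer (extR ρ) a)

vsubst-lamAnswer : (σ : VSub n m) {p : VTerm n} → LamAnswer p → LamAnswer (vsubst σ p)
vsubst-lamAnswer σ (λ-here c)  = λ-here _
vsubst-lamAnswer σ (λ-under a) = λ-under (vsubst-lamAnswer (vextS σ) a)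

vsubst-answer : {σ : VSub n m} → ValueSub σ → {p : VTerm n} → Answer p → Answer (vsubst σ p)
vsubst-answer h (v-here x)  = v-here (vsubst-val h x)
vsubst-answer h (v-under a) = v-under (vsubst-answer (vextS-value h) a)

unrename-val : (ρ : Ren n m) (p : VTerm n) → IsVValue (vrename ρ p) → IsVValue p
unrename-val ρ (var x) _ = var-val x
unrename-val ρ (lam p) _ = lam-val p

unrename-lamAnswer : (ρ : Ren n m) (p : VTerm n) → LamAnswer (vrename ρ p) → LamAnswer p
unrename-lamAnswer ρ (lam p)    _           = λ-here p
unrename-lamAnswer ρ (esub p u) (λ-under a) = λ-under (unrename-lamAnswer (extR ρ) p a)

unrename-answer : (ρ : Ren n m) (p : VTerm n) → Answer (vrename ρ p) → Answer p
unrename-answer ρ (esub p u) (v-under a) = v-under (unrename-answer (extR ρ) p a)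
unrename-answer ρ p          (v-here h)  = v-here (unrename-val ρ p h)

wk₁-vrename : (ρ : Ren n m) (t : VTerm (suc n)) →
              vrename (extR (extR ρ)) (wk₁ t) ≡ wk₁ (vrename (extR ρ) t)
wk₁-vrename ρ t = trans (vrename-∘ _ _ t)
                   (trans (vrename-cong pointwise t) (sym (vrename-∘ _ _ t)))
  where
  pointwise : extR (extR ρ) ∘ extR suc ≗ extR suc ∘ extR ρ
  pointwise zero    = refl
  pointwise (suc i) = refl

wk₁-vsubst : (σ : VSub n m) (t : VTerm (suc n)) →
             vsubst (vextS (vextS σ)) (wk₁ t) ≡ wk₁ (vsubst (vextS σ) t)
wk₁-vsubst σ t = trans (vsubst-vrename _ _ t)
                  (trans (vsubst-cong pointwise t) (sym (vrename-vsubst _ _ t)))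
  where
  pointwise : vextS (vextS σ) ∘ extR suc ≗ wk₁ ∘ vextS σ
  pointwise zero    = refl
  pointwise (suc i) = sym (vrename-wk suc (σ i))

vrename-mContract : (ρ : Ren n m) {p : VTerm n} (a : LamAnswer p) (s : VTerm n) →
                    vrename ρ (mContract a s) ≡ mContract (vrename-lamAnswer ρ a) (vrename ρ s)
vrename-mContract ρ (λ-here c)  s = refl
vrename-mContract ρ (λ-under a) s = cong (λ z → esub z _)
  (trans (vrename-mContract (extR ρ) a (wk s))
         (cong (mContract (vrename-lamAnswer (extR ρ) a)) (vrename-wk ρ s)))

vrename-eContract : (ρ : Ren n m) (t : VTerm (suc n)) {p : VTerm n} (a : Answer p) →
                    vrename ρ (eContract t a) ≡ eContract (vrename (extR ρ) t) (vrename-answer ρ a)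
vrename-eContract ρ t (v-here {v} h) =
  trans (vrename-vsubst ρ (sub₀ v) t)
        (trans (vsubst-cong pointwise t) (sym (vsubst-vrename (sub₀ (vrename ρ v)) (extR ρ) t)))
  where
  pointwise : vrename ρ ∘ sub₀ v ≗ sub₀ (vrename ρ v) ∘ extR ρ
  pointwise zero    = refl
  pointwise (suc i) = refl
vrename-eContract ρ t (v-under a) = cong (λ z → esub z _)
  (trans (vrename-eContract (extR ρ) (wk₁ t) a) (cong (λ z → eContract z (vrename-answer (extR ρ) a)) (wk₁-vrename ρ t)))

vsubst-mContract : (σ : VSub n m) {p : VTerm n} (a : LamAnswer p) (s : VTerm n) →
                   vsubst σ (mContract a s) ≡ mContract (vsubst-lamAnswer σ a) (vsubst σ s)
vsubst-mContract σ (λ-here c)  s = refl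
vsubst-mContract σ (λ-under a) s = cong (λ z → esub z _)
  (trans (vsubst-mContract (vextS σ) a (wk s))
         (cong (mContract (vsubst-lamAnswer (vextS σ) a)) (vsubst-wk σ s)))

vsubst-eContract : {σ : VSub n m} (h : ValueSub σ) (t : VTerm (suc n)) {p : VTerm n} (a : Answer p) →
                   vsubst σ (eContract t a) ≡ eContract (vsubst (vextS σ) t) (vsubst-answer h a)
vsubst-eContract {σ = σ} h t (v-here {v} x) =
  trans (vsubst-vsubst σ (sub₀ v) t)
        (trans (vsubst-cong pointwise t) (sym (vsubst-vsubst (sub₀ (vsubst σ v)) (vextS σ) t)))
  where
  pointwise : vsubst σ ∘ sub₀ v ≗ vsubst (sub₀ (vsubst σ v)) ∘ vextS σ
  pointwise zero    = refl
  pointwise (suc i) = sym (trans (vsubst-vrename _ suc (σ i)) (vsubst-id (λ _ → refl) (σ i)))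
vsubst-eContract {σ = σ} h t (v-under a) = cong (λ z → esub z _)
  (trans (vsubst-eContract (vextS-value h) (wk₁ t) a) (cong (λ z → eContract z (vsubst-answer (vextS-value h) a)) (wk₁-vsubst σ t)))

vrename-step : (ρ : Ren n m) {p q : VTerm n} {k : VKind} → p ⟶[ k ] q → vrename ρ p ⟶[ k ] vrename ρ q
vrename-step ρ (m-rule {s = s} a) = ⟶-resp-≡ (sym (vrename-mContract ρ a s)) (m-rule (vrename-lamAnswer ρ a))
vrename-step ρ (e-rule {t = t} a) = ⟶-resp-≡ (sym (vrename-eContract ρ t a)) (e-rule (vrename-answer ρ a))
vrename-step ρ (ξappL st) = ξappL (vrename-step ρ st)
vrename-step ρ (ξappR st) = ξappR (vrename-step ρ st)
vrename-step ρ (ξsubL st) = ξsubL (vrename-step (extR ρ) st)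
vrename-step ρ (ξsubR st) = ξsubR (vrename-step ρ st)

vsubst-step : {σ : VSub n m} → ValueSub σ → {p q : VTerm n} {k : VKind} →
              p ⟶[ k ] q → vsubst σ p ⟶[ k ] vsubst σ q
vsubst-step {σ = σ} h (m-rule {s = s} a) = ⟶-resp-≡ (sym (vsubst-mContract σ a s)) (m-rule (vsubst-lamAnswer σ a))
vsubst-step h (e-rule {t = t} a) = ⟶-resp-≡ (sym (vsubst-eContract h t a)) (e-rule (vsubst-answer h a))
vsubst-step h (ξappL st) = ξappL (vsubst-step h st)
vsubst-step h (ξappR st) = ξappR (vsubst-step h st)
vsubst-step h (ξsubL st) = ξsubL (vsubst-step (vextS-value h) st)
vsubst-step h (ξsubR st) = ξsubR (vsubst-step h st)

unrename-step : (ρ : Ren n m) (p : VTerm n) {q : VTerm m} {k : VKind} → vrename ρ p ⟶[ k ] q →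
                Σ (VTerm n) λ p' → (p ⟶[ k ] p') × (q ≡ vrename ρ p')
unrename-step ρ (app p s) (m-rule a) =
  let a₀ = unrename-lamAnswer ρ p a in
  mContract a₀ s , m-rule a₀ ,
  trans (cong (λ z → mContract z (vrename ρ s)) (lamAnswer-irr a (vrename-lamAnswer ρ a₀)))
        (sym (vrename-mContract ρ a₀ s))
unrename-step ρ (esub t p) (e-rule a) =
  let a₀ = unrename-answer ρ p a in
  eContract t a₀ , e-rule a₀ ,
  trans (cong (eContract (vrename (extR ρ) t)) (answer-irr a (vrename-answer ρ a₀)))
        (sym (vrename-eContract ρ t a₀))
unrename-step ρ (app p s) (ξappL st) with unrename-step ρ p st
... | p' , st' , e = app p' s , ξappL st' , cong (λ z → app z _) e
unrename-step ρ (app p s) (ξappR st) with unrename-step ρ s st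
... | s' , st' , e = app p s' , ξappR st' , cong (app _) e
unrename-step ρ (esub t p) (ξsubL st) with unrename-step (extR ρ) t st
... | t' , st' , e = esub t' p , ξsubL st' , cong (λ z → esub z _) e
unrename-step ρ (esub t p) (ξsubR st) with unrename-step ρ p st
... | p' , st' , e = esub t p' , ξsubR st' , cong (esub _) e

plug-lamAnswer : (L : SCtx n m) (c : VTerm (suc m)) → LamAnswer (plug L (lam c))
plug-lamAnswer hole      c = λ-here c
plug-lamAnswer (L [ u ]) c = λ-under (plug-lamAnswer L c)

plug-answer : (L : SCtx n m) {v : VTerm m} → IsVValue v → Answer (plug L v)
plug-answer hole      h = v-here h
plug-answer (L [ u ]) h = v-under (plug-answer L h)

lamAnswer-plug : {p : VTerm n} → LamAnswer p →
                 Σ ℕ λ m → Σ (SCtx n m) λ L → Σ (VTerm (suc m)) λ c → p ≡ plug L (lam c)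
lamAnswer-plug (λ-here c) = _ , hole , c , refl
lamAnswer-plug (λ-under {u = u} a) with lamAnswer-plug a
... | m , L , c , e = m , L [ u ] , c , cong (λ z → esub z u) e

answer-plug : {p : VTerm n} → Answer p →
              Σ ℕ λ m → Σ (SCtx n m) λ L → Σ (VTerm m) λ v → IsVValue v × (p ≡ plug L v)
answer-plug (v-here {v} h) = _ , hole , v , h , refl
answer-plug (v-under {u = u} a) with answer-plug a
... | m , L , v , h , e = m , L [ u ] , v , h , cong (λ z → esub z u) e

mContract-plug : (L : SCtx n m) (c : VTerm (suc m)) (u : VTerm n) →
                 mContract (plug-lamAnswer L c) u ≡ plug L (esub c (vrename (wkL L) u))
mContract-plug hole      c u = cong (esub c) (sym (vrename-id (λ _ → refl) u))
mContract-plug (L [ w ]) c u = cong (λ z → esub z w)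
  (trans (mContract-plug L c (wk u)) (cong (λ z → plug L (esub c z)) (vrename-∘ (wkL L) suc u)))

eContract-plug : (L : SCtx n m) (t : VTerm (suc n)) {v : VTerm m} (h : IsVValue v) →
                 eContract t (plug-answer L h) ≡ plug L (vsubst (eσ L v) t)
eContract-plug hole t {v} h = vsubst-cong pointwise t
  where
  pointwise : sub₀ v ≗ eσ hole v
  pointwise zero    = refl
  pointwise (suc i) = refl
eContract-plug (L [ u ]) t {v} h = cong (λ z → esub z u)
  (trans (eContract-plug L (wk₁ t) h)
         (cong (plug L) (trans (vsubst-vrename (eσ L v) (extR suc) t) (vsubst-cong pointwise t))))
  where
  pointwise : eσ L v ∘ extR suc ≗ eσ (L [ u ]) v
  pointwise zero    = refl
  pointwise (suc i) = refl

→vsub-resp-≡ : ∀ {p q q' : VTerm n} {k} → q ≡ q' → p →vsub[ k ] q → p →vsub[ k ] q'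
→vsub-resp-≡ refl s = s

⟶⇒→vsub : ∀ {p q : VTerm n} {k} → p ⟶[ k ] q → p →vsub[ k ] q
⟶⇒→vsub (m-rule {s = s} a) with lamAnswer-plug a
... | m , L , c , refl = →vsub-resp-≡
  (trans (sym (mContract-plug L c s)) (cong (λ z → mContract z s) (lamAnswer-irr (plug-lamAnswer L c) a)))
  (root (mRule L c s))
⟶⇒→vsub (e-rule {t = t} a) with answer-plug a
... | m , L , v , h , refl = →vsub-resp-≡
  (trans (sym (eContract-plug L t h)) (cong (eContract t) (answer-irr (plug-answer L h) a)))
  (root (eRule t L v h))
⟶⇒→vsub (ξappL s) = appL (⟶⇒→vsub s)
⟶⇒→vsub (ξappR s) = appR (⟶⇒→vsub s)
⟶⇒→vsub (ξsubL s) = esubL (⟶⇒→vsub s)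
⟶⇒→vsub (ξsubR s) = esubR (⟶⇒→vsub s)

→vsub⇒⟶ : ∀ {p q : VTerm n} {k} → p →vsub[ k ] q → p ⟶[ k ] q
→vsub⇒⟶ (root (mRule L c u))   = ⟶-resp-≡ (mContract-plug L c u) (m-rule (plug-lamAnswer L c))
→vsub⇒⟶ (root (eRule t L v h)) = ⟶-resp-≡ (eContract-plug L t h) (e-rule (plug-answer L h))
→vsub⇒⟶ (appL s)  = ξappL (→vsub⇒⟶ s)
→vsub⇒⟶ (appR s)  = ξappR (→vsub⇒⟶ s)
→vsub⇒⟶ (esubL s) = ξsubL (→vsub⇒⟶ s)
→vsub⇒⟶ (esubR s) = ξsubR (→vsub⇒⟶ s)

_⟶_ : VTerm n → VTerm n → Set
p ⟶ q = ∃ λ k → p ⟶[ k ] q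

_⟶*_ : VTerm n → VTerm n → Set
_⟶*_ = Star _⟶_

_⟶m*_ : VTerm n → VTerm n → Set
_⟶m*_ = Star (_⟶[ m-step ]_)

eWeight : VKind → ℕ
eWeight m-step = 0
eWeight e-step = 1

eSteps : {p q : VTerm n} → p ⟶* q → ℕ
eSteps ε             = 0
eSteps ((k , _) ◅ d) = eWeight k + eSteps d

eSteps-◅◅ : {p q r : VTerm n} (d : p ⟶* q) (d' : q ⟶* r) → eSteps (d ◅◅ d') ≡ eSteps d + eSteps d'
eSteps-◅◅ ε             d' = refl
eSteps-◅◅ ((k , _) ◅ d) d' =
  trans (cong (eWeight k +_) (eSteps-◅◅ d d')) (sym (+-assoc (eWeight k) (eSteps d) (eSteps d')))

mDerivation : {p q : VTerm n} → p ⟶m* q → Σ (p ⟶* q) λ d → eSteps d ≡ 0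
mDerivation ε        = ε , refl
mDerivation (s ◅ ms) with mDerivation ms
... | d , e = (m-step , s) ◅ d , e

Normal : VTerm n → Set
Normal p = ∀ {k q} → ¬ (p ⟶[ k ] q)

VDer⇒⟶* : {t u : VTerm n} (e : VDer t u) → Σ (t ⟶* u) λ d → eSteps d ≡ eCount e
VDer⇒⟶* done = ε , refl
VDer⇒⟶* (step {k = m-step} s e) with VDer⇒⟶* e
... | d , eq = (m-step , →vsub⇒⟶ s) ◅ d , eq
VDer⇒⟶* (step {k = e-step} s e) with VDer⇒⟶* e
... | d , eq = (e-step , →vsub⇒⟶ s) ◅ d , cong suc eq

Normal⇒VNormal : {p : VTerm n} → Normal p → VNormal p
Normal⇒VNormal np s = np (→vsub⇒⟶ s)

VNormal⇒Normal : {p : VTerm n} → VNormal p → Normal p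
VNormal⇒Normal np s = np (⟶⇒→vsub s)

⟶*⇒VDer : {t u : VTerm n} → t ⟶* u → VDer t u
⟶*⇒VDer ε             = done
⟶*⇒VDer ((_ , s) ◅ d) = step (⟶⇒→vsub s) (⟶*⇒VDer d)

-- The diamond property of vsub
--
-- The only non-trivial overlaps are a step inside the answer of
-- an m- or e-redex, which leaves the redex an answer of the same kind.

sub₀-wk : (v s : VTerm n) → vsubst (sub₀ v) (wk s) ≡ s
sub₀-wk v s = trans (vsubst-vrename (sub₀ v) suc s) (vsubst-id (λ _ → refl) s)

sub₀-wk₁ : (v : VTerm n) (t : VTerm (suc n)) → vsubst (vextS (sub₀ v)) (wk₁ t) ≡ t
sub₀-wk₁ v t = trans (vsubst-vrename _ _ t) (vsubst-id pointwise t)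
  where
  pointwise : ∀ i → vextS (sub₀ v) (extR suc i) ≡ var i
  pointwise zero    = refl
  pointwise (suc i) = refl

wk₁-mContract : {q : VTerm (suc n)} (c : LamAnswer q) (s : VTerm n) →
                wk₁ (mContract c (wk s)) ≡ mContract (vrename-lamAnswer (extR suc) c) (wk (wk s))
wk₁-mContract c s =
  trans (vrename-mContract (extR suc) c (wk s)) (cong (mContract _) (vrename-wk suc s))

wk₁-eContract : (t : VTerm (suc n)) {q : VTerm (suc n)} (c : Answer q) →
                wk₁ (eContract (wk₁ t) c) ≡ eContract (wk₁ (wk₁ t)) (vrename-answer (extR suc) c)
wk₁-eContract t c =
  trans (vrename-eContract (extR suc) (wk₁ t) c)
        (cong (λ z → eContract z (vrename-answer (extR suc) c)) (wk₁-vrename suc t))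

mContract-arg : {p : VTerm n} (a : LamAnswer p) {s s' : VTerm n} {k : VKind} →
                s ⟶[ k ] s' → mContract a s ⟶[ k ] mContract a s'
mContract-arg (λ-here c)  st = ξsubR st
mContract-arg (λ-under a) st = ξsubL (mContract-arg a (vrename-step suc st))

eContract-body : {p : VTerm n} (a : Answer p) {t t' : VTerm (suc n)} {k : VKind} →
                 t ⟶[ k ] t' → eContract t a ⟶[ k ] eContract t' a
eContract-body (v-here h)  st = vsubst-step (sub₀-value h) st
eContract-body (v-under a) st = ξsubL (eContract-body a (vrename-step (extR suc) st))

eContract-lamAnswer : {q : VTerm (suc n)} {u : VTerm n} → LamAnswer q → (a : Answer u) →
                      LamAnswer (eContract q a)
eContract-lamAnswer c (v-here h)  = vsubst-lamAnswer _ c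
eContract-lamAnswer c (v-under a) = λ-under (eContract-lamAnswer (vrename-lamAnswer (extR suc) c) a)

eContract-mContract : {q : VTerm (suc n)} {u : VTerm n} (c : LamAnswer q) (a : Answer u) (s : VTerm n) →
                      eContract (mContract c (wk s)) a ≡ mContract (eContract-lamAnswer c a) s
eContract-mContract c (v-here {v} h) s =
  trans (vsubst-mContract (sub₀ v) c (wk s)) (cong (mContract (vsubst-lamAnswer (sub₀ v) c)) (sub₀-wk v s))
eContract-mContract c (v-under {u = w} a) s = cong (λ z → esub z w)
  (trans (cong (λ z → eContract z a) (wk₁-mContract c s))
         (eContract-mContract (vrename-lamAnswer (extR suc) c) a (wk s)))

eContract-answer : {q : VTerm (suc n)} {u : VTerm n} → Answer q → (a : Answer u) → Answer (eContract q a)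
eContract-answer c (v-here h)  = vsubst-answer (sub₀-value h) c
eContract-answer c (v-under a) = v-under (eContract-answer (vrename-answer (extR suc) c) a)

eContract-eContract : (t : VTerm (suc n)) {q : VTerm (suc n)} {u : VTerm n} (c : Answer q) (a : Answer u) →
                      eContract (eContract (wk₁ t) c) a ≡ eContract t (eContract-answer c a)
eContract-eContract t c (v-here {v} h) =
  trans (vsubst-eContract (sub₀-value h) (wk₁ t) c)
        (cong (λ z → eContract z (vsubst-answer (sub₀-value h) c)) (sub₀-wk₁ v t))
eContract-eContract t c (v-under {u = w} a) = cong (λ z → esub z w)
  (trans (cong (λ z → eContract z a) (wk₁-eContract t c))
         (eContract-eContract (wk₁ t) (vrename-answer (extR suc) c) a))

lamAnswer-step : {p p' : VTerm n} {k : VKind} (a : LamAnswer p) → p ⟶[ k ] p' →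
                 Σ (LamAnswer p') λ a' → ∀ s → mContract a s ⟶[ k ] mContract a' s
lamAnswer-step (λ-under c) (e-rule a) =
  eContract-lamAnswer c a , λ s → ⟶-resp-≡ (eContract-mContract c a s) (e-rule a)
lamAnswer-step (λ-under c) (ξsubL st) with lamAnswer-step c st
... | c' , f = λ-under c' , λ s → ξsubL (f (wk s))
lamAnswer-step (λ-under c) (ξsubR st) = λ-under c , λ s → ξsubR st

answer-step : {p p' : VTerm n} {k : VKind} (a : Answer p) → p ⟶[ k ] p' →
              Σ (Answer p') λ a' → ∀ t → eContract t a ⟶[ k ] eContract t a'
answer-step (v-here h)  st = ⊥-elim (value-stuck h st)
answer-step (v-under c) (e-rule a) =
  eContract-answer c a , λ t → ⟶-resp-≡ (eContract-eContract t c a) (e-rule a)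
answer-step (v-under c) (ξsubL st) with answer-step c st
... | c' , f = v-under c' , λ t → ξsubL (f (wk₁ t))
answer-step (v-under c) (ξsubR st) = v-under c , λ t → ξsubR st

Square : VKind → VKind → VTerm n → VTerm n → Set
Square {n} k₁ k₂ p₁ p₂ = (k₁ ≡ k₂ × p₁ ≡ p₂) ⊎ (Σ (VTerm n) λ r → (p₁ ⟶[ k₂ ] r) × (p₂ ⟶[ k₁ ] r))

square-sym : ∀ {k₁ k₂} {p₁ p₂ : VTerm n} → Square k₁ k₂ p₁ p₂ → Square k₂ k₁ p₂ p₁
square-sym (inj₁ (refl , refl)) = inj₁ (refl , refl)
square-sym (inj₂ (r , s₁ , s₂)) = inj₂ (r , s₂ , s₁)

square-map : (f : VTerm n → VTerm m) → (∀ {a b k} → a ⟶[ k ] b → f a ⟶[ k ] f b) →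
             ∀ {k₁ k₂} {p₁ p₂ : VTerm n} → Square k₁ k₂ p₁ p₂ → Square k₁ k₂ (f p₁) (f p₂)
square-map f ξ (inj₁ (refl , refl)) = inj₁ (refl , refl)
square-map f ξ (inj₂ (r , s₁ , s₂)) = inj₂ (f r , ξ s₁ , ξ s₂)

m-redex-square : {p s q : VTerm n} {k : VKind} (a : LamAnswer p) →
                 app p s ⟶[ k ] q → Square m-step k (mContract a s) q
m-redex-square a (m-rule a') = inj₁ (refl , cong (λ z → mContract z _) (lamAnswer-irr a a'))
m-redex-square a (ξappL st) with lamAnswer-step a st
... | a' , f = inj₂ (_ , f _ , m-rule a')
m-redex-square a (ξappR st) = inj₂ (_ , mContract-arg a st , m-rule a)

e-redex-square : {t : VTerm (suc n)} {p q : VTerm n} {k : VKind} (a : Answer p) →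
                 esub t p ⟶[ k ] q → Square e-step k (eContract t a) q
e-redex-square a (e-rule a') = inj₁ (refl , cong (eContract _) (answer-irr a a'))
e-redex-square a (ξsubL st) = inj₂ (_ , eContract-body a st , e-rule a)
e-redex-square a (ξsubR st) with answer-step a st
... | a' , f = inj₂ (_ , f _ , e-rule a')

diamond : {p p₁ p₂ : VTerm n} {k₁ k₂ : VKind} → p ⟶[ k₁ ] p₁ → p ⟶[ k₂ ] p₂ → Square k₁ k₂ p₁ p₂
diamond (m-rule a) s₂          = m-redex-square a s₂
diamond (e-rule a) s₂          = e-redex-square a s₂
diamond s₁ (m-rule a)          = square-sym (m-redex-square a s₁)
diamond s₁ (e-rule a)          = square-sym (e-redex-square a s₁)
diamond (ξappL s₁) (ξappL s₂) = square-map (λ z → app z _) ξappL (diamond s₁ s₂)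
diamond (ξappL s₁) (ξappR s₂) = inj₂ (_ , ξappR s₂ , ξappL s₁)
diamond (ξappR s₁) (ξappL s₂) = inj₂ (_ , ξappL s₂ , ξappR s₁)
diamond (ξappR s₁) (ξappR s₂) = square-map (app _) ξappR (diamond s₁ s₂)
diamond (ξsubL s₁) (ξsubL s₂) = square-map (λ z → esub z _) ξsubL (diamond s₁ s₂)
diamond (ξsubL s₁) (ξsubR s₂) = inj₂ (_ , ξsubR s₂ , ξsubL s₁)
diamond (ξsubR s₁) (ξsubL s₂) = inj₂ (_ , ξsubL s₂ , ξsubR s₁)
diamond (ξsubR s₁) (ξsubR s₂) = square-map (esub _) ξsubR (diamond s₁ s₂)

NormalizesWith : VTerm n → ℕ → Set
NormalizesWith {n} p C = Σ (VTerm n) λ q → Σ (p ⟶* q) λ d → (eSteps d ≡ C) × Normal q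

descent-step : {p q p' : VTerm n} {k : VKind} (d : p ⟶* q) → Normal q → p ⟶[ k ] p' →
               Σ ℕ λ C' → (eSteps d ≡ eWeight k + C') × NormalizesWith p' C'
descent-step ε nq st = ⊥-elim (nq st)
descent-step ((k₁ , s₁) ◅ d) nq st with diamond st s₁
... | inj₁ (refl , refl) = eSteps d , refl , _ , d , refl , nq
... | inj₂ (r , p'⟶r , p₁⟶r) with descent-step d nq p₁⟶r
...   | C' , eq , (q , d' , refl , nq') =
  eWeight k₁ + C' ,
  trans (cong (eWeight k₁ +_) eq) (x∙yz≈y∙xz (eWeight k₁) _ C') ,
  q , (k₁ , p'⟶r) ◅ d' , refl , nq'

descent : {p p' : VTerm n} {C : ℕ} → NormalizesWith p C → (d : p ⟶* p') →
          Σ ℕ λ C' → (C ≡ eSteps d + C') × NormalizesWith p' C'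
descent nd ε = _ , refl , nd
descent (q , d₀ , refl , nq) ((k , s) ◅ d) with descent-step d₀ nq s
... | C₁ , eq₁ , nd₁ with descent nd₁ d
...   | C' , eq , nd' =
  C' , trans eq₁ (trans (cong (eWeight k +_) eq) (sym (+-assoc (eWeight k) (eSteps d) C'))) , nd'

normal-normalizesWith : {p : VTerm n} {C : ℕ} → Normal p → NormalizesWith p C → C ≡ 0
normal-normalizesWith np (_ , ε , refl , _)          = refl
normal-normalizesWith np (_ , (_ , s) ◅ d , _ , _) = ⊥-elim (np s)

eSteps-unique : {p q q' : VTerm n} (d : p ⟶* q) (d' : p ⟶* q') →
                Normal q → Normal q' → eSteps d ≡ eSteps d'
eSteps-unique d d' nq nq' with descent (_ , d , refl , nq) d'
... | C' , eq , nd with normal-normalizesWith nq' nd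
...   | refl = trans eq (+-comm (eSteps d') 0)

-- Structural equivalence: the vsub counterpart of the σ-rules
--
-- The
-- compatible, symmetric and transitive closure ~ of these three axioms is
-- a strong bisimulation for vsub preserving the kind of steps.

infix 4 _▷_ _~₁_ _~_

data _▷_ {n : ℕ} : VTerm n → VTerm n → Set where
  σ-appL : (t : VTerm (suc n)) (u s : VTerm n) → app (esub t u) s ▷ esub (app t (wk s)) u
  σ-appR : (v : VTerm n) (s : VTerm (suc n)) (u : VTerm n) → IsVValue v →
           app v (esub s u) ▷ esub (app (wk v) s) u
  σ-sub  : (t : VTerm (suc n)) (s : VTerm (suc n)) (u : VTerm n) →
           esub t (esub s u) ▷ esub (esub (wk₁ t) s) u

data _~₁_ {n : ℕ} : VTerm n → VTerm n → Set where
  fwd  : ∀ {p q} → p ▷ q → p ~₁ q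
  bwd  : ∀ {p q} → q ▷ p → p ~₁ q
  ~appL : ∀ {p p' q} → p ~₁ p' → app p q ~₁ app p' q
  ~appR : ∀ {p q q'} → q ~₁ q' → app p q ~₁ app p q'
  ~subL : ∀ {p p' : VTerm (suc n)} {q} → p ~₁ p' → esub p q ~₁ esub p' q
  ~subR : ∀ {p q q'} → q ~₁ q' → esub p q ~₁ esub p q'

_~_ : VTerm n → VTerm n → Set
_~_ = Star _~₁_

~₁-sym : {p q : VTerm n} → p ~₁ q → q ~₁ p
~₁-sym (fwd r)   = bwd r
~₁-sym (bwd r)   = fwd r
~₁-sym (~appL r) = ~appL (~₁-sym r)
~₁-sym (~appR r) = ~appR (~₁-sym r)
~₁-sym (~subL r) = ~subL (~₁-sym r)
~₁-sym (~subR r) = ~subR (~₁-sym r)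

~-sym : {p q : VTerm n} → p ~ q → q ~ p
~-sym = reverse ~₁-sym

≡⇒~ : {p q : VTerm n} → p ≡ q → p ~ q
≡⇒~ refl = ε

▷-resp-≡ : {p q q' : VTerm n} → q ≡ q' → p ▷ q → p ▷ q'
▷-resp-≡ refl r = r

vrename-▷ : (ρ : Ren n m) {p q : VTerm n} → p ▷ q → vrename ρ p ▷ vrename ρ q
vrename-▷ ρ (σ-appL t u s) =
  ▷-resp-≡ (cong (λ z → esub (app _ z) _) (sym (vrename-wk ρ s))) (σ-appL _ _ _)
vrename-▷ ρ (σ-appR v s u h) =
  ▷-resp-≡ (cong (λ z → esub (app z _) _) (sym (vrename-wk ρ v))) (σ-appR _ _ _ (vrename-val ρ h))
vrename-▷ ρ (σ-sub t s u) =
  ▷-resp-≡ (cong (λ z → esub (esub z _) _) (sym (wk₁-vrename ρ t))) (σ-sub _ _ _)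

vsubst-▷ : {σ : VSub n m} → ValueSub σ → {p q : VTerm n} → p ▷ q → vsubst σ p ▷ vsubst σ q
vsubst-▷ {σ = σ} h (σ-appL t u s) =
  ▷-resp-≡ (cong (λ z → esub (app _ z) _) (sym (vsubst-wk σ s))) (σ-appL _ _ _)
vsubst-▷ {σ = σ} h (σ-appR v s u hv) =
  ▷-resp-≡ (cong (λ z → esub (app z _) _) (sym (vsubst-wk σ v))) (σ-appR _ _ _ (vsubst-val h hv))
vsubst-▷ {σ = σ} h (σ-sub t s u) =
  ▷-resp-≡ (cong (λ z → esub (esub z _) _) (sym (wk₁-vsubst σ t))) (σ-sub _ _ _)

vrename-~₁ : (ρ : Ren n m) {p q : VTerm n} → p ~₁ q → vrename ρ p ~₁ vrename ρ q
vrename-~₁ ρ (fwd r)   = fwd (vrename-▷ ρ r)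
vrename-~₁ ρ (bwd r)   = bwd (vrename-▷ ρ r)
vrename-~₁ ρ (~appL r) = ~appL (vrename-~₁ ρ r)
vrename-~₁ ρ (~appR r) = ~appR (vrename-~₁ ρ r)
vrename-~₁ ρ (~subL r) = ~subL (vrename-~₁ (extR ρ) r)
vrename-~₁ ρ (~subR r) = ~subR (vrename-~₁ ρ r)

vsubst-~₁ : {σ : VSub n m} → ValueSub σ → {p q : VTerm n} → p ~₁ q → vsubst σ p ~₁ vsubst σ q
vsubst-~₁ h (fwd r)   = fwd (vsubst-▷ h r)
vsubst-~₁ h (bwd r)   = bwd (vsubst-▷ h r)
vsubst-~₁ h (~appL r) = ~appL (vsubst-~₁ h r)
vsubst-~₁ h (~appR r) = ~appR (vsubst-~₁ h r)
vsubst-~₁ h (~subL r) = ~subL (vsubst-~₁ (vextS-value h) r)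
vsubst-~₁ h (~subR r) = ~subR (vsubst-~₁ h r)

mContract-~₁ : {p : VTerm n} (a : LamAnswer p) {s s' : VTerm n} → s ~₁ s' → mContract a s ~₁ mContract a s'
mContract-~₁ (λ-here c)  r = ~subR r
mContract-~₁ (λ-under a) r = ~subL (mContract-~₁ a (vrename-~₁ suc r))

eContract-~₁ : {p : VTerm n} (a : Answer p) {t t' : VTerm (suc n)} → t ~₁ t' → eContract t a ~₁ eContract t' a
eContract-~₁ (v-here h)  r = vsubst-~₁ (sub₀-value h) r
eContract-~₁ (v-under a) r = ~subL (eContract-~₁ a (vrename-~₁ (extR suc) r))

eContract-appL : (t : VTerm (suc n)) (s : VTerm n) {p : VTerm n} (a : Answer p) →
                 app (eContract t a) s ~ eContract (app t (wk s)) a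
eContract-appL t s (v-here {v} h) = ≡⇒~ (cong (app _) (sym (sub₀-wk v s)))
eContract-appL t s (v-under {u = w} a) =
  fwd (σ-appL _ w s) ◅ gmap (λ z → esub z w) ~subL (eContract-appL (wk₁ t) (wk s) a) ◅◅
  ≡⇒~ (cong (λ z → esub (eContract (app (wk₁ t) z) a) w) (sym (vrename-wk suc s)))

eContract-appR : (v : VTerm n) (s : VTerm (suc n)) {p : VTerm n} (a : Answer p) → IsVValue v →
                 app v (eContract s a) ~ eContract (app (wk v) s) a
eContract-appR v s (v-here {v₀} h) hv = ≡⇒~ (cong (λ z → app z _) (sym (sub₀-wk v₀ v)))
eContract-appR v s (v-under {u = w} a) hv =
  fwd (σ-appR v _ w hv) ◅ gmap (λ z → esub z w) ~subL (eContract-appR (wk v) (wk₁ s) a (vrename-val suc hv)) ◅◅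
  ≡⇒~ (cong (λ z → esub (eContract (app z (wk₁ s)) a) w) (sym (vrename-wk suc v)))

eContract-sub : (t s : VTerm (suc n)) {p : VTerm n} (a : Answer p) →
                esub t (eContract s a) ~ eContract (esub (wk₁ t) s) a
eContract-sub t s (v-here {v} h) = ≡⇒~ (cong (λ z → esub z _) (sym (sub₀-wk₁ v t)))
eContract-sub t s (v-under {u = w} a) =
  fwd (σ-sub t _ w) ◅ gmap (λ z → esub z w) ~subL (eContract-sub (wk₁ t) (wk₁ s) a) ◅◅
  ≡⇒~ (cong (λ z → esub (eContract (esub z (wk₁ s)) a) w) (sym (wk₁-vrename suc t)))

value-~₁ : {v w : VTerm n} → IsVValue v → ¬ (v ~₁ w)
value-~₁ (var-val x) (fwd ())
value-~₁ (var-val x) (bwd ())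
value-~₁ (lam-val t) (fwd ())
value-~₁ (lam-val t) (bwd ())

lamAnswer-~₁ : {p p' : VTerm n} (a : LamAnswer p) → p ~₁ p' →
               Σ (LamAnswer p') λ a' → ∀ s → mContract a s ~ mContract a' s
lamAnswer-~₁ (λ-under c) (fwd (σ-sub t s u)) =
  λ-under (λ-under (vrename-lamAnswer (extR suc) c)) ,
  λ b → fwd (▷-resp-≡ (cong (λ z → esub (esub z s) u) (wk₁-mContract c b)) (σ-sub _ s u)) ◅ ε
lamAnswer-~₁ (λ-under (λ-under c)) (bwd (σ-sub t s u)) =
  let c₀ = unrename-lamAnswer (extR suc) t c in
  λ-under c₀ ,
  λ b → bwd (▷-resp-≡ (cong (λ z → esub (esub z s) u)
                         (trans (wk₁-mContract c₀ b)
                                (cong (λ z → mContract z (wk (wk b)))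
                                      (lamAnswer-irr (vrename-lamAnswer (extR suc) c₀) c))))
                      (σ-sub _ s u)) ◅ ε
lamAnswer-~₁ (λ-under c) (~subL r) with lamAnswer-~₁ c r
... | c' , f = λ-under c' , λ s → gmap (λ z → esub z _) ~subL (f (wk s))
lamAnswer-~₁ (λ-under c) (~subR r) = λ-under c , λ s → ~subR r ◅ ε

answer-~₁ : {p p' : VTerm n} (a : Answer p) → p ~₁ p' →
            Σ (Answer p') λ a' → ∀ t → eContract t a ~ eContract t a'
answer-~₁ (v-here h) r = ⊥-elim (value-~₁ h r)
answer-~₁ (v-under c) (fwd (σ-sub t s u)) =
  v-under (v-under (vrename-answer (extR suc) c)) ,
  λ b → fwd (▷-resp-≡ (cong (λ z → esub (esub z s) u) (wk₁-eContract b c)) (σ-sub _ s u)) ◅ ε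
answer-~₁ (v-under (v-here ())) (bwd (σ-appL t u s))
answer-~₁ (v-under (v-here ())) (bwd (σ-appR v s u h))
answer-~₁ (v-under (v-here ())) (bwd (σ-sub t s u))
answer-~₁ (v-under (v-under c)) (bwd (σ-sub t s u)) =
  let c₀ = unrename-answer (extR suc) t c in
  v-under c₀ ,
  λ b → bwd (▷-resp-≡ (cong (λ z → esub (esub z s) u)
                         (trans (wk₁-eContract b c₀)
                                (cong (eContract (wk₁ (wk₁ b))) (answer-irr (vrename-answer (extR suc) c₀) c))))
                      (σ-sub _ s u)) ◅ ε
answer-~₁ (v-under c) (~subL r) with answer-~₁ c r
... | c' , f = v-under c' , λ t → gmap (λ z → esub z _) ~subL (f (wk₁ t))
answer-~₁ (v-under c) (~subR r) = v-under c , λ t → ~subR r ◅ ε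

Matched : VTerm n → VKind → VTerm n → Set
Matched {n} q k p' = Σ (VTerm n) λ q' → (q ⟶[ k ] q') × (p' ~ q')

matched-map : (f : VTerm n → VTerm m) → (∀ {a b k} → a ⟶[ k ] b → f a ⟶[ k ] f b) →
              (∀ {a b} → a ~₁ b → f a ~₁ f b) →
              ∀ {q k p'} → Matched q k p' → Matched (f q) k (f p')
matched-map f ξ ξ~ (q' , s , r) = f q' , ξ s , gmap f ξ~ r

▷-simulateˡ : {p q p' : VTerm n} {k : VKind} → p ▷ q → p ⟶[ k ] p' → Matched q k p'
▷-simulateˡ (σ-appL t u s) (m-rule (λ-under c)) = _ , ξsubL (m-rule c) , ε
▷-simulateˡ (σ-appL t u s) (ξappL (e-rule a)) = _ , e-rule a , eContract-appL t s a
▷-simulateˡ (σ-appL t u s) (ξappL (ξsubL st)) = _ , ξsubL (ξappL st) , fwd (σ-appL _ u s) ◅ ε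
▷-simulateˡ (σ-appL t u s) (ξappL (ξsubR st)) = _ , ξsubR st , fwd (σ-appL t _ s) ◅ ε
▷-simulateˡ (σ-appL t u s) (ξappR st) =
  _ , ξsubL (ξappR (vrename-step suc st)) , fwd (σ-appL t u _) ◅ ε
▷-simulateˡ (σ-appR .(lam c) s u (lam-val c)) (m-rule (λ-here .c)) =
  _ , ξsubL (m-rule (λ-here (wk₁ c))) , fwd (σ-sub c s u) ◅ ε
▷-simulateˡ (σ-appR v s u h) (ξappL st) = ⊥-elim (value-stuck h st)
▷-simulateˡ (σ-appR v s u h) (ξappR (e-rule a)) = _ , e-rule a , eContract-appR v s a h
▷-simulateˡ (σ-appR v s u h) (ξappR (ξsubL st)) = _ , ξsubL (ξappR st) , fwd (σ-appR v _ u h) ◅ ε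
▷-simulateˡ (σ-appR v s u h) (ξappR (ξsubR st)) = _ , ξsubR st , fwd (σ-appR v s _ h) ◅ ε
▷-simulateˡ (σ-sub t s u) (e-rule (v-under a)) = _ , ξsubL (e-rule a) , ε
▷-simulateˡ (σ-sub t s u) (ξsubL st) =
  _ , ξsubL (ξsubL (vrename-step (extR suc) st)) , fwd (σ-sub _ s u) ◅ ε
▷-simulateˡ (σ-sub t s u) (ξsubR (e-rule a)) = _ , e-rule a , eContract-sub t s a
▷-simulateˡ (σ-sub t s u) (ξsubR (ξsubL st)) = _ , ξsubL (ξsubR st) , fwd (σ-sub t _ u) ◅ ε
▷-simulateˡ (σ-sub t s u) (ξsubR (ξsubR st)) = _ , ξsubR st , fwd (σ-sub t s _) ◅ ε

▷-simulateʳ : {p q p' : VTerm n} {k : VKind} → q ▷ p → p ⟶[ k ] p' → Matched q k p'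
▷-simulateʳ (σ-appL t u s) (e-rule a) = _ , ξappL (e-rule a) , ~-sym (eContract-appL t s a)
▷-simulateʳ (σ-appL t u s) (ξsubL (m-rule c)) = _ , m-rule (λ-under c) , ε
▷-simulateʳ (σ-appL t u s) (ξsubL (ξappL st)) = _ , ξappL (ξsubL st) , bwd (σ-appL _ u s) ◅ ε
▷-simulateʳ (σ-appL t u s) (ξsubL (ξappR st)) with unrename-step suc s st
... | s' , st' , refl = _ , ξappR st' , bwd (σ-appL t u s') ◅ ε
▷-simulateʳ (σ-appL t u s) (ξsubR st) = _ , ξappL (ξsubR st) , bwd (σ-appL t _ s) ◅ ε
▷-simulateʳ (σ-appR v s u h) (e-rule a) = _ , ξappR (e-rule a) , ~-sym (eContract-appR v s a h)
▷-simulateʳ (σ-appR .(lam c) s u (lam-val c)) (ξsubL (m-rule (λ-here .(wk₁ c)))) =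
  _ , m-rule (λ-here c) , bwd (σ-sub c s u) ◅ ε
▷-simulateʳ (σ-appR v s u h) (ξsubL (ξappL st)) = ⊥-elim (value-stuck (vrename-val suc h) st)
▷-simulateʳ (σ-appR v s u h) (ξsubL (ξappR st)) = _ , ξappR (ξsubL st) , bwd (σ-appR v _ u h) ◅ ε
▷-simulateʳ (σ-appR v s u h) (ξsubR st) = _ , ξappR (ξsubR st) , bwd (σ-appR v s _ h) ◅ ε
▷-simulateʳ (σ-sub t s u) (e-rule a) = _ , ξsubR (e-rule a) , ~-sym (eContract-sub t s a)
▷-simulateʳ (σ-sub t s u) (ξsubL (e-rule a)) = _ , e-rule (v-under a) , ε
▷-simulateʳ (σ-sub t s u) (ξsubL (ξsubL st)) with unrename-step (extR suc) t st
... | t' , st' , refl = _ , ξsubL st' , bwd (σ-sub t' s u) ◅ ε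
▷-simulateʳ (σ-sub t s u) (ξsubL (ξsubR st)) = _ , ξsubR (ξsubL st) , bwd (σ-sub t _ u) ◅ ε
▷-simulateʳ (σ-sub t s u) (ξsubR st) = _ , ξsubR (ξsubR st) , bwd (σ-sub t s _) ◅ ε

~₁-simulate : {p q p' : VTerm n} {k : VKind} → p ~₁ q → p ⟶[ k ] p' → Matched q k p'
~₁-simulate (fwd r) st = ▷-simulateˡ r st
~₁-simulate (bwd r) st = ▷-simulateʳ r st
~₁-simulate (~appL r) (m-rule a) with lamAnswer-~₁ a r
... | a' , f = _ , m-rule a' , f _
~₁-simulate (~appL r) (ξappL st) = matched-map (λ z → app z _) ξappL ~appL (~₁-simulate r st)
~₁-simulate (~appL r) (ξappR st) = _ , ξappR st , ~appL r ◅ ε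
~₁-simulate (~appR r) (m-rule a) = _ , m-rule a , mContract-~₁ a r ◅ ε
~₁-simulate (~appR r) (ξappL st) = _ , ξappL st , ~appR r ◅ ε
~₁-simulate (~appR r) (ξappR st) = matched-map (app _) ξappR ~appR (~₁-simulate r st)
~₁-simulate (~subL r) (e-rule a) = _ , e-rule a , eContract-~₁ a r ◅ ε
~₁-simulate (~subL r) (ξsubL st) = matched-map (λ z → esub z _) ξsubL ~subL (~₁-simulate r st)
~₁-simulate (~subL r) (ξsubR st) = _ , ξsubR st , ~subL r ◅ ε
~₁-simulate (~subR r) (e-rule a) with answer-~₁ a r
... | a' , f = _ , e-rule a' , f _
~₁-simulate (~subR r) (ξsubL st) = _ , ξsubL st , ~subR r ◅ ε
~₁-simulate (~subR r) (ξsubR st) = matched-map (esub _) ξsubR ~subR (~₁-simulate r st)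

~-simulate : {p q p' : VTerm n} {k : VKind} → p ~ q → p ⟶[ k ] p' → Matched q k p'
~-simulate ε st = _ , st , ε
~-simulate (r ◅ rs) st with ~₁-simulate r st
... | q₁ , st₁ , r₁ with ~-simulate rs st₁
...   | q' , st' , r' = q' , st' , r₁ ◅◅ r'

_⟶m?_ : VTerm n → VTerm n → Set
p ⟶m? q = (p ≡ q) ⊎ (p ⟶[ m-step ] q)

⟶m?⇒⟶m* : {p q : VTerm n} → p ⟶m? q → p ⟶m* q
⟶m?⇒⟶m* (inj₁ refl) = ε
⟶m?⇒⟶m* (inj₂ s)    = s ◅ ε

m-strip : {p a b : VTerm n} → p ⟶[ m-step ] a → p ⟶m* b → Σ (VTerm n) λ w → (a ⟶m* w) × (b ⟶m? w)
m-strip st ε = _ , ε , inj₂ st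
m-strip st (s₁ ◅ rest) with diamond st s₁
... | inj₁ (_ , refl) = _ , rest , inj₁ refl
... | inj₂ (r , a⟶r , p₁⟶r) with m-strip p₁⟶r rest
...   | w , r⟶w , o = w , a⟶r ◅ r⟶w , o

m-confluence : {p a b : VTerm n} → p ⟶m* a → p ⟶m* b → Σ (VTerm n) λ w → (a ⟶m* w) × (b ⟶m* w)
m-confluence ε pb = _ , pb , ε
m-confluence (s ◅ rest) pb with m-strip s pb
... | w₁ , p₁w₁ , o with m-confluence rest p₁w₁
...   | w , aw , w₁w = w , aw , ⟶m?⇒⟶m* o ◅◅ w₁w

e-after-m : {p q w : VTerm n} → p ⟶[ e-step ] q → p ⟶m* w →
            Σ (VTerm n) λ w' → (w ⟶[ e-step ] w') × (q ⟶m* w')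
e-after-m st ε = _ , st , ε
e-after-m st (s₁ ◅ rest) with diamond st s₁
... | inj₁ (() , _)
... | inj₂ (r , q⟶r , p₁⟶r) with e-after-m p₁⟶r rest
...   | w' , ww' , rw' = w' , ww' , q⟶r ◅ rw'

~-simulate-m* : {p q p' : VTerm n} → p ~ q → p ⟶m* p' → Σ (VTerm n) λ q' → (q ⟶m* q') × (p' ~ q')
~-simulate-m* r ε = _ , ε , r
~-simulate-m* r (s ◅ d) with ~-simulate r s
... | q₁ , s' , r₁ with ~-simulate-m* r₁ d
...   | q' , d' , r' = q' , s' ◅ d' , r'

normal-~ : {p q : VTerm n} → p ~ q → Normal p → Normal q
normal-~ r np st with ~-simulate (~-sym r) st
... | _ , st' , _ = np st'

normal-m* : {p q : VTerm n} → Normal p → p ⟶m* q → p ≡ q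
normal-m* np ε       = refl
normal-m* np (s ◅ d) = ⊥-elim (np s)

infix 4 _≅_
_≅_ : VTerm n → VTerm n → Set
_≅_ {n} p q = Σ (VTerm n) λ a → Σ (VTerm n) λ b → (p ⟶m* a) × (q ⟶m* b) × (a ~ b)

-- ≅ is an equivalence; transitivity joins the middle term by m-confluence
≅-sym : {p q : VTerm n} → p ≅ q → q ≅ p
≅-sym (a , b , pa , qb , r) = b , a , qb , pa , ~-sym r

≅-trans : {p q r : VTerm n} → p ≅ q → q ≅ r → p ≅ r
≅-trans (a₁ , b₁ , pa₁ , qb₁ , r₁) (a₂ , b₂ , qa₂ , rb₂ , r₂) with m-confluence qb₁ qa₂
... | w , b₁w , a₂w with ~-simulate-m* (~-sym r₁) b₁w | ~-simulate-m* r₂ a₂w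
...   | x , a₁x , wx | y , b₂y , wy = x , y , pa₁ ◅◅ a₁x , rb₂ ◅◅ b₂y , ~-sym wx ◅◅ wy

≅-e-step : {p q p₀ p₁ : VTerm n} → p ≅ q → p ⟶m* p₀ → p₀ ⟶[ e-step ] p₁ →
           Σ (VTerm n) λ q' → Σ (q ⟶* q') λ d → (eSteps d ≡ 1) × (p₁ ≅ q')
≅-e-step (a , b , pa , qb , a~b) pp₀ st with m-confluence pp₀ pa
... | w , p₀w , aw with e-after-m st p₀w | ~-simulate-m* a~b aw
...   | w' , ww' , p₁w' | w₂ , bw₂ , w~w₂ with ~-simulate w~w₂ ww'
...     | w₂' , w₂w₂' , w'~w₂' with mDerivation (qb ◅◅ bw₂)
...       | d , d-noE = w₂' , d ◅◅ ((e-step , w₂w₂') ◅ ε) ,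
                        trans (eSteps-◅◅ d _) (cong (_+ 1) d-noE) ,
                        (w' , w₂' , p₁w' , ε , w'~w₂')

-- Simulation of the shuffling calculus in vsub
--
-- Through the embedding, the two sides of a σ-step become m-joinable up to
-- ~, and a βv-step becomes one e-step surrounded by m-steps.

Mirrors : ShufKind → VTerm n → VTerm n → Set
Mirrors σ-step  p q = p ≅ q
Mirrors {n} βv-step p q =
  Σ (VTerm n) λ p₀ → Σ (VTerm n) λ q₀ → (p ⟶m* p₀) × (p₀ ⟶[ e-step ] q₀) × (q ⟶m* q₀)

mirrors-map : (f : VTerm n → VTerm m) → (∀ {a b k} → a ⟶[ k ] b → f a ⟶[ k ] f b) →
              (∀ {a b} → a ~₁ b → f a ~₁ f b) →
              ∀ {k p q} → Mirrors k p q → Mirrors k (f p) (f q)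
mirrors-map f ξ ξ~ {σ-step}  (a , b , pa , qb , r)     = f a , f b , gmap f ξ pa , gmap f ξ qb , gmap f ξ~ r
mirrors-map f ξ ξ~ {βv-step} (p₀ , q₀ , pp₀ , s , qq₀) = f p₀ , f q₀ , gmap f ξ pp₀ , ξ s , gmap f ξ qq₀

-- under (λx.B)u, which becomes B[x←u] after one m-step
mirrors-lamApp : (u : VTerm n) {k : ShufKind} {p q : VTerm (suc n)} →
                 Mirrors k p q → Mirrors k (app (lam p) u) (app (lam q) u)
mirrors-lamApp u {σ-step} (a , b , pa , qb , r) =
  esub a u , esub b u ,
  m-rule (λ-here _) ◅ gmap (λ z → esub z u) ξsubL pa ,
  m-rule (λ-here _) ◅ gmap (λ z → esub z u) ξsubL qb ,
  gmap (λ z → esub z u) ~subL r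
mirrors-lamApp u {βv-step} (p₀ , q₀ , pp₀ , s , qq₀) =
  esub p₀ u , esub q₀ u ,
  m-rule (λ-here _) ◅ gmap (λ z → esub z u) ξsubL pp₀ ,
  ξsubL s ,
  m-rule (λ-here _) ◅ gmap (λ z → esub z u) ξsubL qq₀

embed-value : {v : Term n} → IsValue v → IsVValue (embed v)
embed-value (var-val x) = var-val x
embed-value (lam-val t) = lam-val _

-- (the substitution of _[0≔_] is local to Defs, hence the pattern lambda)
embed-β : (t : Term (suc n)) (v : Term n) → embed (t [0≔ v ]) ≡ vsubst (sub₀ (embed v)) (embed t)
embed-β t v = trans (embed-subst _ t) (vsubst-cong (λ { zero → refl ; (suc i) → refl }) (embed t))

shuf-mirrored : {t t' : Term n} {k : ShufKind} → t →shuf[ k ] t' → Mirrors k (embed t) (embed t')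
shuf-mirrored (root (σ₁ t u s)) =
  _ , _ , ξappL (m-rule (λ-here _)) ◅ ε , m-rule (λ-here _) ◅ ε ,
  fwd (▷-resp-≡ (cong (λ z → esub (app (embed t) z) (embed u)) (sym (embed-rename suc s)))
                (σ-appL (embed t) (embed u) (embed s))) ◅ ε
shuf-mirrored (root (σ₃ v s u h)) =
  _ , _ , ξappR (m-rule (λ-here _)) ◅ ε , m-rule (λ-here _) ◅ ε ,
  fwd (▷-resp-≡ (cong (λ z → esub (app z (embed s)) (embed u)) (sym (embed-rename suc v)))
                (σ-appR (embed v) (embed s) (embed u) (embed-value h))) ◅ ε
shuf-mirrored (root (βv t v h)) =
  _ , _ , m-rule (λ-here _) ◅ ε , e-rule (v-here (embed-value h)) , ≡⇒⟶m* (embed-β t v)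
  where
  ≡⇒⟶m* : {p q : VTerm _} → p ≡ q → p ⟶m* q
  ≡⇒⟶m* refl = ε
shuf-mirrored (appL st)   = mirrors-map (λ z → app z _) ξappL ~appL (shuf-mirrored st)
shuf-mirrored (appR st)   = mirrors-map (app _) ξappR ~appR (shuf-mirrored st)
shuf-mirrored (lamApp st) = mirrors-lamApp _ (shuf-mirrored st)

Represents : Term n → VTerm n → Set
Represents t p = embed t ≅ p

represents-embed : (t : Term n) → Represents t (embed t)
represents-embed t = embed t , embed t , ε , ε , ε

βvWeight : ShufKind → ℕ
βvWeight σ-step  = 0
βvWeight βv-step = 1

βvCount-step : {t u s : Term n} {k : ShufKind} (st : t →shuf[ k ] u) (d : ShufDer u s) →
               βvCount (step st d) ≡ βvWeight k + βvCount d
βvCount-step {k = σ-step}  st d = refl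
βvCount-step {k = βv-step} st d = refl

represents-σ : {t t' : Term n} {p : VTerm n} → Represents t p → t →shuf[ σ-step ] t' → Represents t' p
represents-σ r st = ≅-trans (≅-sym (shuf-mirrored st)) r

represents-step : {t t' : Term n} {p : VTerm n} {k : ShufKind} → Represents t p → t →shuf[ k ] t' →
                  Σ (VTerm n) λ p' → Σ (p ⟶* p') λ d → (eSteps d ≡ βvWeight k) × Represents t' p'
represents-step {k = σ-step} r st = _ , ε , refl , represents-σ r st
represents-step {k = βv-step} r st with shuf-mirrored st
... | p₀ , q₀ , tp₀ , s , t'q₀ with ≅-e-step r tp₀ s
...   | p' , d , d-oneE , q₀≅p' = p' , d , d-oneE , ≅-trans (q₀ , q₀ , t'q₀ , ε , ε) q₀≅p'

represents-derivation : {t u : Term n} {p : VTerm n} (d : ShufDer t u) → Represents t p →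
                        Σ (VTerm n) λ p' → Σ (p ⟶* p') λ e → (eSteps e ≡ βvCount d) × Represents u p'
represents-derivation done r = _ , ε , refl , r
represents-derivation (step st d) r with represents-step r st
... | p₁ , e₁ , eq₁ , r₁ with represents-derivation d r₁
...   | p' , e₂ , eq₂ , r' =
  p' , e₁ ◅◅ e₂ ,
  trans (eSteps-◅◅ e₁ e₂) (trans (cong₂ _+_ eq₁ eq₂) (sym (βvCount-step st d))) , r'

-- Normal forms: a shuf-normal term is represented by a vsub-normal form
--
-- mnf t is reached from embed t by m-steps, contracting the β-redexes that
-- are not under an abstraction.  When t is shuf-normal, mnf t is vsub-normal:
-- an e-redex in it would come from a βv- or σ₃-redex of t, an m-redex from a
-- σ₁-redex.

mnf : Term n → VTerm n
mnf (var x)           = var x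
mnf (lam b)           = lam (embed b)
mnf (app (lam b) a)   = esub (mnf b) (mnf a)
mnf (app (var x) a)   = app (var x) (mnf a)
mnf (app (app f g) a) = app (mnf (app f g)) (mnf a)

embed-m*-mnf : (t : Term n) → embed t ⟶m* mnf t
embed-m*-mnf (var x)           = ε
embed-m*-mnf (lam b)           = ε
embed-m*-mnf (app (lam b) a)   =
  m-rule (λ-here (embed b)) ◅
  gmap (λ z → esub z (embed a)) ξsubL (embed-m*-mnf b) ◅◅ gmap (esub (mnf b)) ξsubR (embed-m*-mnf a)
embed-m*-mnf (app (var x) a)   = gmap (app (var x)) ξappR (embed-m*-mnf a)
embed-m*-mnf (app (app f g) a) =
  gmap (λ z → app z (embed a)) ξappL (embed-m*-mnf (app f g)) ◅◅ gmap (app _) ξappR (embed-m*-mnf a)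

mnf-answer : (a : Term n) → Answer (mnf a) →
             IsValue a ⊎ Σ (Term (suc n)) λ b → Σ (Term n) λ a' → a ≡ app (lam b) a'
mnf-answer (var x)           _           = inj₁ (var-val x)
mnf-answer (lam a)           _           = inj₁ (lam-val a)
mnf-answer (app (lam b) a')  _           = inj₂ (b , a' , refl)
mnf-answer (app (var x) a')  (v-here ())
mnf-answer (app (app f g) a') (v-here ())

mnf-lamAnswer : (f g : Term n) → LamAnswer (mnf (app f g)) → Σ (Term (suc n)) λ b → f ≡ lam b
mnf-lamAnswer (lam b) g _ = b , refl

mnf-normal : (t : Term n) → ShufNormal t → Normal (mnf t)
mnf-normal (var x) nt st = value-stuck (var-val x) st
mnf-normal (lam b) nt st = value-stuck (lam-val _) st
mnf-normal (app (lam b) a) nt (e-rule c) with mnf-answer a c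
... | inj₁ hv               = nt (root (βv b a hv))
... | inj₂ (b' , a' , refl) = nt (root (σ₃ (lam b) b' a' (lam-val b)))
mnf-normal (app (lam b) a) nt (ξsubL st) = mnf-normal b (λ s → nt (lamApp s)) st
mnf-normal (app (lam b) a) nt (ξsubR st) = mnf-normal a (λ s → nt (appR s)) st
mnf-normal (app (var x) a) nt (ξappR st) = mnf-normal a (λ s → nt (appR s)) st
mnf-normal (app (app f g) a) nt (m-rule c) with mnf-lamAnswer f g c
... | b , refl = nt (root (σ₁ b g a))
mnf-normal (app (app f g) a) nt (ξappL st) = mnf-normal (app f g) (λ s → nt (appL s)) st
mnf-normal (app (app f g) a) nt (ξappR st) = mnf-normal a (λ s → nt (appR s)) st

represents-normal : {t : Term n} {p : VTerm n} → Represents t p → ShufNormal t →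
                    Σ (VTerm n) λ q → (p ⟶m* q) × Normal q
represents-normal {t = t} (a , b , ta , pb , a~b) nt with m-confluence ta (embed-m*-mnf t)
... | w , aw , mnf⟶w with normal-m* (mnf-normal t nt) mnf⟶w
...   | refl with ~-simulate-m* a~b aw
...     | q , bq , mnf~q = q , pb ◅◅ bq , normal-~ mnf~q (mnf-normal t nt)

shuf⇒vsub : {t u : Term n} (d : ShufDer t u) → ShufNormal u →
            Σ (VTerm n) λ q → Σ (embed t ⟶* q) λ e → (eSteps e ≡ βvCount d) × Normal q
shuf⇒vsub {t = t} d nu with represents-derivation d (represents-embed t)
... | p , e , eq , r with represents-normal r nu
...   | q , pq , nq with mDerivation pq
...     | e' , e'-noE =
  q , e ◅◅ e' , trans (eSteps-◅◅ e e') (trans (cong₂ _+_ eq e'-noE) (+-comm (βvCount d) 0)) , nq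

ShufProgress : Term n → Set
ShufProgress {n} t = ShufNormal t ⊎ (Σ ShufKind λ k → Σ (Term n) λ u → t →shuf[ k ] u)

NoRootRedex : Term n → Term n → Set
NoRootRedex f a = ∀ {k u} → ¬ (app f a ↦shuf[ k ] u)

root-progress : (f a : Term n) →
                (Σ ShufKind λ k → Σ (Term n) λ u → app f a ↦shuf[ k ] u) ⊎ NoRootRedex f a
root-progress (app (lam t) u)   s                 = inj₁ (_ , _ , σ₁ t u s)
root-progress (app (var y) g)   a                 = inj₂ λ { (σ₃ _ _ _ ()) }
root-progress (app (app f g) h) a                 = inj₂ λ { (σ₃ _ _ _ ()) }
root-progress (var x)           (app (lam s) u)   = inj₁ (_ , _ , σ₃ (var x) s u (var-val x))
root-progress (lam b)           (app (lam s) u)   = inj₁ (_ , _ , σ₃ (lam b) s u (lam-val b))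
root-progress (lam b)           (var y)           = inj₁ (_ , _ , βv b (var y) (var-val y))
root-progress (lam b)           (lam c)           = inj₁ (_ , _ , βv b (lam c) (lam-val c))
root-progress (var x)           (var y)           = inj₂ λ ()
root-progress (var x)           (lam c)           = inj₂ λ ()
root-progress (var x)           (app (var y) g)   = inj₂ λ ()
root-progress (var x)           (app (app f g) h) = inj₂ λ ()
root-progress (lam b)           (app (var y) g)   = inj₂ λ { (βv _ _ ()) }
root-progress (lam b)           (app (app f g) h) = inj₂ λ { (βv _ _ ()) }

mutual
  shuf-progress : (t : Term n) → ShufProgress t
  shuf-progress (var x)   = inj₁ λ { (root ()) }
  shuf-progress (lam b)   = inj₁ λ { (root ()) }
  shuf-progress (app f a) with root-progress f a
  ... | inj₁ (k , u , r) = inj₂ (k , u , root r)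
  ... | inj₂ nr with shuf-progress a
  ...   | inj₂ (k , a' , st) = inj₂ (k , _ , appR st)
  ...   | inj₁ na with shuf-progress f
  ...     | inj₂ (k , f' , st) = inj₂ (k , _ , appL st)
  ...     | inj₁ nf = body-progress f a nr na nf

  -- the remaining position of a step in  f a  is the body of  f = λx.b
  body-progress : (f a : Term n) → NoRootRedex f a → ShufNormal a → ShufNormal f → ShufProgress (app f a)
  body-progress (lam b) a nr na nf with shuf-progress b
  ... | inj₂ (k , b' , st) = inj₂ (k , _ , lamApp st)
  ... | inj₁ nb = inj₁ λ { (root r) → nr r ; (appR st) → na st ; (appL st) → nf st ; (lamApp st) → nb st }
  body-progress (var x) a nr na nf =
    inj₁ λ { (root r) → nr r ; (appR st) → na st ; (appL st) → nf st }
  body-progress (app g h) a nr na nf =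
    inj₁ λ { (root r) → nr r ; (appR st) → na st ; (appL st) → nf st }

-- a polynomial interpretation: σ-measure (t u) + 1 = 2 (σ-measure t + 1) (σ-measure u + 1)
_⊛_ : ℕ → ℕ → ℕ
a ⊛ b = 2 * a * b + 2 * a + 2 * b + 1

σ-measure : Term n → ℕ
σ-measure (var x)   = 0
σ-measure (lam b)   = suc (σ-measure b)
σ-measure (app t u) = σ-measure t ⊛ σ-measure u

σ-measure-rename : (ρ : Ren n m) (t : Term n) → σ-measure (rename ρ t) ≡ σ-measure t
σ-measure-rename ρ (var x)   = refl
σ-measure-rename ρ (lam t)   = cong suc (σ-measure-rename (extR ρ) t)
σ-measure-rename ρ (app t u) = cong₂ _⊛_ (σ-measure-rename ρ t) (σ-measure-rename ρ u)

⊛-monoˡ-< : ∀ {a a'} b → a < a' → a ⊛ b < a' ⊛ b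
⊛-monoˡ-< b lt =
  +-monoˡ-< 1 (+-monoˡ-< (2 * b) (+-mono-≤-< (*-monoˡ-≤ b (*-monoʳ-≤ 2 (<⇒≤ lt))) (*-monoʳ-< 2 lt)))

⊛-monoʳ-< : ∀ a {b b'} → b < b' → a ⊛ b < a ⊛ b'
⊛-monoʳ-< a lt =
  +-monoˡ-< 1 (+-mono-≤-< (+-monoˡ-≤ (2 * a) (*-monoʳ-≤ (2 * a) (<⇒≤ lt))) (*-monoʳ-< 2 lt))

<-of-≡ : ∀ {x y} d → x ≡ suc (y + d) → y < x
<-of-≡ {y = y} d eq = ≡-subst (y <_) (sym eq) (s≤s (m≤m+n y d))

σ₁-drop : ∀ a b c → suc (a ⊛ c) ⊛ b < (suc a ⊛ b) ⊛ c
σ₁-drop a b c = <-of-≡ (4 * b * c + 2 * b + 4 * c + 1) (expanded a b c)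
  where
  expanded : ∀ a b c →
    2 * (2 * suc a * b + 2 * suc a + 2 * b + 1) * c + 2 * (2 * suc a * b + 2 * suc a + 2 * b + 1) + 2 * c + 1
    ≡ suc ((2 * suc (2 * a * c + 2 * a + 2 * c + 1) * b + 2 * suc (2 * a * c + 2 * a + 2 * c + 1) + 2 * b + 1)
           + (4 * b * c + 2 * b + 4 * c + 1))
  expanded = solve-∀

σ₃-drop : ∀ v s b → suc (v ⊛ s) ⊛ b < v ⊛ (suc s ⊛ b)
σ₃-drop v s b = <-of-≡ (4 * b * v + 2 * b + 4 * v + 1) (expanded v s b)
  where
  expanded : ∀ v s b →
    2 * v * (2 * suc s * b + 2 * suc s + 2 * b + 1) + 2 * v + 2 * (2 * suc s * b + 2 * suc s + 2 * b + 1) + 1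
    ≡ suc ((2 * suc (2 * v * s + 2 * v + 2 * s + 1) * b + 2 * suc (2 * v * s + 2 * v + 2 * s + 1) + 2 * b + 1)
           + (4 * b * v + 2 * b + 4 * v + 1))
  expanded = solve-∀

σ-measure-drop : {t t' : Term n} → t →shuf[ σ-step ] t' → σ-measure t' < σ-measure t
σ-measure-drop (root (σ₁ t u s)) rewrite σ-measure-rename suc s = σ₁-drop (σ-measure t) (σ-measure u) (σ-measure s)
σ-measure-drop (root (σ₃ v s u h)) rewrite σ-measure-rename suc v = σ₃-drop (σ-measure v) (σ-measure s) (σ-measure u)
σ-measure-drop (appL {u = u} st)   = ⊛-monoˡ-< (σ-measure u) (σ-measure-drop st)
σ-measure-drop (appR {t = t} st)   = ⊛-monoʳ-< (σ-measure t) (σ-measure-drop st)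
σ-measure-drop (lamApp {u = u} st) = ⊛-monoˡ-< (σ-measure u) (s≤s (σ-measure-drop st))

-- a βv-step consumes exactly one of the remaining e-steps
one-less : ∀ {C C' x : ℕ} → C ≡ x + C' → x ≡ 1 → C' < C
one-less {C' = C'} refl refl = n<1+n C'

ShufNormalizes : Term n → Set
ShufNormalizes {n} t = Σ (Term n) λ u → ShufDer t u × ShufNormal u

-- Each
-- βv-step of t costs one of the C e-steps (random descent), and σ-steps
-- decrease σ-measure t: induction on (C , σ-measure t) lexicographically.
represented-normalizes : (t : Term n) (p : VTerm n) {C : ℕ} → Represents t p → NormalizesWith p C →
                         Acc _<_ C → Acc _<_ (σ-measure t) → ShufNormalizes t
represented-normalizes t p r nd accC accσ with shuf-progress t
... | inj₁ nt = t , done , nt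
represented-normalizes t p r nd accC (acc smaller) | inj₂ (σ-step , t' , st)
  with represented-normalizes t' p (represents-σ r st) nd accC (smaller (σ-measure-drop st))
... | u , d , nu = u , step st d , nu
represented-normalizes t p r nd (acc smaller) accσ | inj₂ (βv-step , t' , st)
  with represents-step r st
... | p' , e , e-oneE , r' with descent nd e
...   | C' , C≡ , nd'
  with represented-normalizes t' p' r' nd' (smaller (one-less C≡ e-oneE)) (<-wellFounded (σ-measure t'))
...     | u , d , nu = u , step st d , nu

vsub⇒shuf : (t : Term n) {u : VTerm n} → VDer (embed t) u → VNormal u → ShufNormalizes t
vsub⇒shuf t {u} e nu with VDer⇒⟶* e
... | d , _ = represented-normalizes t (embed t) (represents-embed t) (u , d , refl , VNormal⇒Normal nu)
                (<-wellFounded _) (<-wellFounded _)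

corollary2 : ∀ {n : ℕ} (t : Term n) →
    (((Σ (Term n) λ u → ShufDer t u × ShufNormal u) →
       (Σ (VTerm n) λ u → VDer (embed t) u × VNormal u))
     × ((Σ (VTerm n) λ u → VDer (embed t) u × VNormal u) →
       (Σ (Term n) λ u → ShufDer t u × ShufNormal u)))
    × (∀ {u : Term n} {u' : VTerm n} (d : ShufDer t u) (e : VDer (embed t) u') →
         ShufNormal u → VNormal u' → βvCount d ≡ eCount e)
corollary2 t = (shuf-normalizing⇒vsub-normalizing , vsub-normalizing⇒shuf-normalizing) , same-count
  where
  shuf-normalizing⇒vsub-normalizing : ShufNormalizes t → Σ (VTerm _) λ u → VDer (embed t) u × VNormal u
  shuf-normalizing⇒vsub-normalizing (u , d , nu) with shuf⇒vsub d nu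
  ... | q , e , _ , nq = q , ⟶*⇒VDer e , Normal⇒VNormal nq

  vsub-normalizing⇒shuf-normalizing : (Σ (VTerm _) λ u → VDer (embed t) u × VNormal u) → ShufNormalizes t
  vsub-normalizing⇒shuf-normalizing (u , e , nu) = vsub⇒shuf t e nu

  -- both counts equal the e-steps of the vsub derivation mirroring d (random descent)
  same-count : ∀ {u u'} (d : ShufDer t u) (e : VDer (embed t) u') →
               ShufNormal u → VNormal u' → βvCount d ≡ eCount e
  same-count d e nu nu' with shuf⇒vsub d nu | VDer⇒⟶* e
  ... | q , e₁ , e₁≡d , nq | e₂ , e₂≡e =
    trans (sym e₁≡d) (trans (eSteps-unique e₁ e₂ nq (VNormal⇒Normal nu')) e₂≡e)
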